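{- Let $G = C_n$ be the cycle on $n \ge 3$ vertices and let $Q \subseteq V(G)$. A non-empty $c_Q$-visible set of $C_n$ exists if and only if $|Q| \le 2$.
   Context: For a graph $G$ and $X \subseteq V(G)$, two vertices $u,v$ are $X$-visible if there exists a shortest $(u,v)$-path $P$ in $G$ with $V(P)\cap X \subseteq \{u,v\}$; a set $Y$ is $X$-visible if every two vertices of $Y$ are $X$-visible. For $Q\subseteq V(G)$, a set $W\subseteq \overline{Q}=V(G)\setminus Q$ is $c_Q$-visible (co-visible with respect to $Q$) if $W$ is $Q$-visible and $u,w$ are $Q$-visible for all $u\in Q$, $w\in W$. -}

module Defs where

open import Data.Nat using (ℕ; zero; suc; _+_; _≤_)
open import Data.Fin using (Fin; toℕ)
open import Data.Fin.Subset using (Subset; _∈_; _⊆_; ∁; ∣_∣; Nonempty)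
open import Data.List using (List; []; _∷_)
import Data.List.Membership.Propositional as LM
open import Data.Product using (_×_; Σ; ∃)
open import Data.Sum using (_⊎_)
open import Relation.Binary.PropositionalEquality using (_≡_)

CycSucc : (n : ℕ) → Fin n → Fin n → Set
CycSucc n u w = (suc (toℕ u) ≡ toℕ w) ⊎ ((suc (toℕ u) ≡ n) × (toℕ w ≡ 0))

CycAdj : (n : ℕ) → Fin n → Fin n → Set
CycAdj n u w = CycSucc n u w ⊎ CycSucc n w u

data Walk (n : ℕ) : Fin n → Fin n → Set where
  [_]  : (u : Fin n) → Walk n u u
  _∷_  : {u w v : Fin n} → CycAdj n u w → Walk n w v → Walk n u v

len : {n : ℕ} {u v : Fin n} → Walk n u v → ℕ
len [ u ] = 0
len (e ∷ p) = suc (len p)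

verts : {n : ℕ} {u v : Fin n} → Walk n u v → List (Fin n)
verts [ u ] = u ∷ []
verts (_∷_ {u = u} e p) = u ∷ verts p

-- P is a shortest (u,v)-path: no (u,v)-walk is shorter
-- (a shortest walk is necessarily a path).
IsShortest : {n : ℕ} {u v : Fin n} → Walk n u v → Set
IsShortest {n} {u} {v} p = (q : Walk n u v) → len p ≤ len q

VisibleFrom : (n : ℕ) → Subset n → Fin n → Fin n → Set
VisibleFrom n X u v =
  Σ (Walk n u v) λ p → IsShortest p ×
    ((x : Fin n) → x LM.∈ verts p → x ∈ X → (x ≡ u) ⊎ (x ≡ v))

SetVisible : (n : ℕ) → Subset n → Subset n → Set
SetVisible n X Y = (u v : Fin n) → u ∈ Y → v ∈ Y → VisibleFrom n X u v

CoVisible : (n : ℕ) → Subset n → Subset n → Set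
CoVisible n Q W =
  (W ⊆ ∁ Q) × SetVisible n Q W ×
  ((u w : Fin n) → u ∈ Q → w ∈ W → VisibleFrom n Q u w)

{-# OPTIONS --safe #-}

-- A nonempty c_Q-visible set contains a vertex w ∉ Q that is Q-visible from every q ∈ Q, and such a w
-- gives the c_Q-visible set {w}. If Q contained q₁ < q₂ < q₃, two of them would cut the cycle into two
-- arcs with w inside one and the third vertex inside the other, so every walk from that vertex to w
-- would meet Q again. If Q ⊆ {a, b} with a < b and b - a ≥ 2, the midpoint of the arc a, …, b is seen
-- from a and from b along the two halves, which are shortest walks since each is at most half the
-- cycle. If a and b are adjacent, a rotation turns them into n-1 and 0, where b - a = n-1 ≥ 2.
module Submission where

open import Defs
open import Data.Bool using (true; false)
open import Data.Empty using (⊥)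
open import Data.Fin using (Fin; zero; suc; toℕ; fromℕ; fromℕ<; inject₁; lower₁)
open import Data.Fin.Properties
  using (toℕ<n; toℕ-injective; toℕ-fromℕ; toℕ-fromℕ<; toℕ-inject₁; toℕ-lower₁)
import Data.Fin.Properties as Finₚ
open import Data.Fin.Subset using (Subset; _∈_; ∁; ⁅_⁆; ∣_∣; Nonempty)
open import Data.Fin.Subset.Properties using (∣p∣≤∣x∷p∣; x∈⁅x⁆; x∈⁅y⁆⇒x≡y; x∈∁p⇒x∉p; x∉p⇒x∈∁p)
open import Data.List using (_∷_; map)
open import Data.List.Membership.Propositional using (find; lose) renaming (_∈_ to _∈ₗ_)
open import Data.List.Membership.Propositional.Properties using (∈-map⁻)
open import Data.List.Relation.Unary.All as All using (All; []; _∷_)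
open import Data.List.Relation.Unary.Any as Any using (Any; here; there)
open import Data.Nat
  using (ℕ; zero; suc; _+_; _∸_; _≤_; _<_; _⊓_; ∣_-_∣; z≤n; s≤s; ⌊_/2⌋; ⌈_/2⌉; _≟_; _<?_; _≤?_)
open import Data.Nat.Properties
open import Data.Product as Product using (Σ; ∃; ∃₂; _×_; _,_; proj₁; proj₂)
open import Data.Sum as Sum using (_⊎_; inj₁; inj₂)
open import Data.Vec.Base using ([]; _∷_)
import Data.Vec.Base as Vec
open import Function using (_∘_)
open import Function.Bundles using (_⇔_; mk⇔)
open import Relation.Binary.Definitions using (tri<; tri≈; tri>)
open import Relation.Binary.PropositionalEquality
  using (_≡_; _≢_; refl; sym; trans; cong; subst; subst₂; ≢-sym; module ≡-Reasoning)
open import Relation.Nullary using (¬_; yes; no; contradiction)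
open import Relation.Nullary.Decidable using (Dec; _×-dec_; decidable-stable)

open ≡-Reasoning

private
  variable
    n : ℕ
    m : ℕ
    u v w x y z a b : Fin n
    A B : Fin n → Set

∈-verts-head : (p : Walk n u v) → u ∈ₗ verts p
∈-verts-head [ u ]   = here refl
∈-verts-head (e ∷ p) = here refl

swap-adj : CycAdj n x y → CycAdj n y x
swap-adj = Sum.swap

_▷_ : Walk n u v → CycAdj n v w → Walk n u w
[ u ]   ▷ e = e ∷ [ _ ]
(e′ ∷ p) ▷ e = e′ ∷ (p ▷ e)

len-▷ : (p : Walk n u v) (e : CycAdj n v w) → len (p ▷ e) ≡ suc (len p)
len-▷ [ u ]    e = refl
len-▷ (e′ ∷ p) e = cong suc (len-▷ p e)

∈-verts-▷ : (p : Walk n u v) (e : CycAdj n v w) → x ∈ₗ verts (p ▷ e) → x ∈ₗ verts p ⊎ x ≡ w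
∈-verts-▷ [ u ]    e (here x≡u)         = inj₁ (here x≡u)
∈-verts-▷ [ u ]    e (there (here x≡w)) = inj₂ x≡w
∈-verts-▷ (e′ ∷ p) e (here x≡u)         = inj₁ (here x≡u)
∈-verts-▷ (e′ ∷ p) e (there x∈p▷e)      = Sum.map₁ there (∈-verts-▷ p e x∈p▷e)

reverse : Walk n u v → Walk n v u
reverse [ u ]   = [ u ]
reverse (e ∷ p) = reverse p ▷ swap-adj e

len-reverse : (p : Walk n u v) → len (reverse p) ≡ len p
len-reverse [ u ]   = refl
len-reverse (e ∷ p) = trans (len-▷ (reverse p) (swap-adj e)) (cong suc (len-reverse p))

∈-verts-reverse : (p : Walk n u v) → x ∈ₗ verts (reverse p) → x ∈ₗ verts p
∈-verts-reverse [ u ]   x∈p = x∈p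
∈-verts-reverse (e ∷ p) x∈p with ∈-verts-▷ (reverse p) (swap-adj e) x∈p
... | inj₁ x∈rp = there (∈-verts-reverse p x∈rp)
... | inj₂ x≡u  = here x≡u

module _ (f : Fin n → Fin n) (f-adj : ∀ {x y} → CycAdj n x y → CycAdj n (f x) (f y)) where

  map-walk : Walk n u v → Walk n (f u) (f v)
  map-walk [ u ]   = [ f u ]
  map-walk (e ∷ p) = f-adj e ∷ map-walk p

  len-map-walk : (p : Walk n u v) → len (map-walk p) ≡ len p
  len-map-walk [ u ]   = refl
  len-map-walk (e ∷ p) = cong suc (len-map-walk p)

  verts-map-walk : (p : Walk n u v) → verts (map-walk p) ≡ map f (verts p)
  verts-map-walk [ u ]   = refl
  verts-map-walk (e ∷ p) = cong (f _ ∷_) (verts-map-walk p)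

-- VisibleFrom n X is Visible n (λ x → x ∈ X) definitionally.
Visible : (n : ℕ) → (Fin n → Set) → Fin n → Fin n → Set
Visible n A u v =
  Σ (Walk n u v) λ p → IsShortest p × ((x : Fin n) → x ∈ₗ verts p → A x → x ≡ u ⊎ x ≡ v)

CoVisibleVertex : (n : ℕ) → (Fin n → Set) → Fin n → Set
CoVisibleVertex n A w = ¬ A w × (∀ u → A u → Visible n A u w)

Pair : Fin n → Fin n → Fin n → Set
Pair a b x = x ≡ a ⊎ x ≡ b

visible-refl : Visible n A u u
visible-refl {u = u} = [ u ] , (λ _ → z≤n) , λ { x (here x≡u) _ → inj₁ x≡u }

visible-sym : Visible n A u v → Visible n A v u
visible-sym (p , p-shortest , p-avoids) =
  reverse p ,
  (λ q → subst₂ _≤_ (sym (len-reverse p)) (len-reverse q) (p-shortest (reverse q))) ,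
  (λ x x∈p Ax → Sum.swap (p-avoids x (∈-verts-reverse p x∈p) Ax))

visible-mono : (∀ {x} → B x → A x) → Visible n A u v → Visible n B u v
visible-mono B⊆A (p , p-shortest , p-avoids) = p , p-shortest , λ x x∈p Bx → p-avoids x x∈p (B⊆A Bx)

covisible-mono : (∀ {x} → B x → A x) → CoVisibleVertex n A w → CoVisibleVertex n B w
covisible-mono B⊆A (w∉A , visible) = w∉A ∘ B⊆A , λ u Bu → visible-mono B⊆A (visible u (B⊆A Bu))

visible-hit : (vis : Visible n A u w) → Any (λ z → A z × z ≢ u) (verts (proj₁ vis)) → A w
visible-hit (p , _ , p-avoids) hit with find hit
... | z , z∈p , Az , z≢u with p-avoids z z∈p Az
...   | inj₁ z≡u  = contradiction z≡u z≢u
...   | inj₂ refl = Az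

covisible⇒covisible-vertex : {Q W : Subset n} → CoVisible n Q W → w ∈ W → CoVisibleVertex n (_∈ Q) w
covisible⇒covisible-vertex (W⊆∁Q , _ , visible) w∈W = x∈∁p⇒x∉p (W⊆∁Q w∈W) , λ u u∈Q → visible u _ u∈Q w∈W

covisible-vertex⇒covisible-⁅⁆ : {Q : Subset n} → CoVisibleVertex n (_∈ Q) w → CoVisible n Q ⁅ w ⁆
covisible-vertex⇒covisible-⁅⁆ {w = w} {Q = Q} (w∉Q , visible) =
  (λ x∈⁅w⁆ → x∉p⇒x∈∁p (λ x∈Q → w∉Q (subst (_∈ Q) (x∈⁅y⁆⇒x≡y w x∈⁅w⁆) x∈Q))) ,
  (λ u v u∈⁅w⁆ v∈⁅w⁆ →
    subst₂ (Visible _ _) (sym (x∈⁅y⁆⇒x≡y w u∈⁅w⁆)) (sym (x∈⁅y⁆⇒x≡y w v∈⁅w⁆)) visible-refl) ,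
  (λ u v u∈Q v∈⁅w⁆ → subst (Visible _ _ u) (sym (x∈⁅y⁆⇒x≡y w v∈⁅w⁆)) (visible u u∈Q))

-- Crossing an interval

Between : Fin n → Fin n → Fin n → Set
Between a b x = toℕ a < toℕ x × toℕ x < toℕ b

between? : (a b x : Fin n) → Dec (Between a b x)
between? a b x = (toℕ a <? toℕ x) ×-dec (toℕ x <? toℕ b)

closed-interval : toℕ a ≤ toℕ x → toℕ x ≤ toℕ b → ¬ Between a b x → Pair a b x
closed-interval {a = a} {x = x} {b = b} a≤x x≤b ¬a<x<b with toℕ a ≟ toℕ x | toℕ x ≟ toℕ b
... | yes a≡x | _        = inj₁ (toℕ-injective (sym a≡x))
... | no _    | yes x≡b  = inj₂ (toℕ-injective x≡b)
... | no a≢x  | no x≢b   = contradiction (≤∧≢⇒< a≤x a≢x , ≤∧≢⇒< x≤b x≢b) ¬a<x<b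

adj-closure : CycAdj n x y → Between a b x → toℕ a ≤ toℕ y × toℕ y ≤ toℕ b
adj-closure {a = a} {b = b} (inj₁ (inj₁ 1+x≡y)) (a<x , x<b) =
  subst (λ t → toℕ a ≤ t × t ≤ toℕ b) 1+x≡y (≤-trans (<⇒≤ a<x) (n≤1+n _) , x<b)
adj-closure {b = b} (inj₁ (inj₂ (1+x≡n , _))) (_ , x<b) =
  contradiction (subst (_≤ toℕ b) 1+x≡n x<b) (<⇒≱ (toℕ<n b))
adj-closure {a = a} {b = b} (inj₂ (inj₁ 1+y≡x)) (a<x , x<b) =
  ≤-pred (subst (toℕ a <_) (sym 1+y≡x) a<x) , ≤-trans (n≤1+n _) (subst (_≤ toℕ b) (sym 1+y≡x) (<⇒≤ x<b))
adj-closure {a = a} (inj₂ (inj₂ (_ , x≡0))) (a<x , _) = contradiction (subst (toℕ a <_) x≡0 a<x) n≮0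

leave-between : CycAdj n x y → Between a b x → ¬ Between a b y → Pair a b y
leave-between e a<x<b = Product.uncurry closed-interval (adj-closure e a<x<b)

exit-between : (p : Walk n x y) → Between a b x → ¬ Between a b y → Any (Pair a b) (verts p)
exit-between [ x ] a<x<b ¬a<y<b = contradiction a<x<b ¬a<y<b
exit-between {a = a} {b = b} (_∷_ {w = z} e p) a<x<b ¬a<y<b with between? a b z
... | yes a<z<b = there (exit-between p a<z<b ¬a<y<b)
... | no ¬a<z<b = there (lose (∈-verts-head p) (leave-between e a<x<b ¬a<z<b))

enter-between : (p : Walk n x y) → ¬ Between a b x → Between a b y → Any (Pair a b) (verts p)
enter-between [ x ] ¬a<x<b a<y<b = contradiction a<y<b ¬a<x<b
enter-between {a = a} {b = b} (_∷_ {w = z} e p) ¬a<x<b a<y<b with between? a b z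
... | yes a<z<b = here (leave-between (swap-adj e) a<z<b ¬a<x<b)
... | no ¬a<z<b = there (enter-between p ¬a<z<b a<y<b)

covisible-walk : CoVisibleVertex n A w → A u → Walk n u w
covisible-walk (_ , visible) Au = proj₁ (visible _ Au)

covisible-walk-misses : (cv : CoVisibleVertex n A w) (Au : A u) → A a → A b → a ≢ u → b ≢ u →
                        ¬ Any (Pair a b) (verts (covisible-walk cv Au))
covisible-walk-misses (w∉A , visible) Au Aa Ab a≢u b≢u hit =
  w∉A (visible-hit (visible _ Au) (Any.map (λ { (inj₁ refl) → Aa , a≢u ; (inj₂ refl) → Ab , b≢u }) hit))

three-obstacles⇒¬covisible : {q₁ q₂ q₃ : Fin n} → A q₁ → A q₂ → A q₃ → toℕ q₁ < toℕ q₂ → toℕ q₂ < toℕ q₃ →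
                             ¬ CoVisibleVertex n A w
three-obstacles⇒¬covisible {A = A} {w = w} {q₁ = q₁} {q₂ = q₂} {q₃ = q₃} A₁ A₂ A₃ q₁<q₂ q₂<q₃ cv@(w∉A , _)
  with between? q₁ q₃ w | between? q₁ q₂ w
... | no ¬q₁<w<q₃ | _ =
  covisible-walk-misses cv A₂ A₁ A₃ (Finₚ.<⇒≢ q₁<q₂) (≢-sym (Finₚ.<⇒≢ q₂<q₃))
    (exit-between (covisible-walk cv A₂) (q₁<q₂ , q₂<q₃) ¬q₁<w<q₃)
... | yes _ | yes q₁<w<q₂ =
  covisible-walk-misses cv A₃ A₁ A₂ (Finₚ.<⇒≢ (<-trans q₁<q₂ q₂<q₃)) (Finₚ.<⇒≢ q₂<q₃)
    (enter-between (covisible-walk cv A₃) (λ (_ , q₃<q₂) → <-asym q₂<q₃ q₃<q₂) q₁<w<q₂)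
... | yes (q₁<w , w<q₃) | no ¬q₁<w<q₂ =
  covisible-walk-misses cv A₁ A₂ A₃ (≢-sym (Finₚ.<⇒≢ q₁<q₂)) (≢-sym (Finₚ.<⇒≢ (<-trans q₁<q₂ q₂<q₃)))
    (enter-between (covisible-walk cv A₁) (λ (q₂<q₁ , _) → <-asym q₁<q₂ q₂<q₁) (q₂<w , w<q₃))
  where
  q₂<w : toℕ q₂ < toℕ w
  q₂<w = ≤∧≢⇒< (≮⇒≥ (λ w<q₂ → ¬q₁<w<q₂ (q₁<w , w<q₂))) (λ q₂≡w → w∉A (subst A (toℕ-injective q₂≡w) A₂))

nonempty : (p : Subset n) → 1 ≤ ∣ p ∣ → Nonempty p
nonempty (true  ∷ p) _ = zero , Vec.here
nonempty (false ∷ p) h = Product.map suc Vec.there (nonempty p h)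

two-sorted : (p : Subset n) → 2 ≤ ∣ p ∣ → ∃₂ λ x y → x ∈ p × y ∈ p × toℕ x < toℕ y
two-sorted (true ∷ p) (s≤s h) with nonempty p h
... | y , y∈p = zero , suc y , Vec.here , Vec.there y∈p , s≤s z≤n
two-sorted (false ∷ p) h with two-sorted p h
... | x , y , x∈p , y∈p , x<y = suc x , suc y , Vec.there x∈p , Vec.there y∈p , s≤s x<y

three-sorted : (p : Subset n) → 3 ≤ ∣ p ∣ →
  ∃₂ λ x y → ∃ λ z → x ∈ p × y ∈ p × z ∈ p × toℕ x < toℕ y × toℕ y < toℕ z
three-sorted (true ∷ p) (s≤s h) with two-sorted p h
... | y , z , y∈p , z∈p , y<z =
  zero , suc y , suc z , Vec.here , Vec.there y∈p , Vec.there z∈p , s≤s z≤n , s≤s y<z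
three-sorted (false ∷ p) h with three-sorted p h
... | x , y , z , x∈p , y∈p , z∈p , x<y , y<z =
  suc x , suc y , suc z , Vec.there x∈p , Vec.there y∈p , Vec.there z∈p , s≤s x<y , s≤s y<z

x∈p⇒1≤∣p∣ : {p : Subset n} → x ∈ p → 1 ≤ ∣ p ∣
x∈p⇒1≤∣p∣ Vec.here                 = s≤s z≤n
x∈p⇒1≤∣p∣ {p = s ∷ p} (Vec.there x∈p) = ≤-trans (x∈p⇒1≤∣p∣ x∈p) (∣p∣≤∣x∷p∣ s p)

∣p∣≤1⇒⊆⁅⁆ : (p : Subset (suc n)) → ∣ p ∣ ≤ 1 → ∃ λ c → ∀ {x} → x ∈ p → x ≡ c
∣p∣≤1⇒⊆⁅⁆ (true ∷ p) (s≤s ∣p∣≤0) = zero , λ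
  { Vec.here → refl
  ; (Vec.there x∈p) → contradiction (≤-trans (x∈p⇒1≤∣p∣ x∈p) ∣p∣≤0) λ () }
∣p∣≤1⇒⊆⁅⁆ {zero} (false ∷ []) _ = zero , λ { {zero} () }
∣p∣≤1⇒⊆⁅⁆ {suc n} (false ∷ p) h with ∣p∣≤1⇒⊆⁅⁆ p h
... | c , p⊆c = suc c , λ { (Vec.there x∈p) → cong suc (p⊆c x∈p) }

∣p∣≤2⇒⊆pair : (p : Subset (suc n)) → ∣ p ∣ ≤ 2 → ∃₂ λ a b → ∀ {x} → x ∈ p → Pair a b x
∣p∣≤2⇒⊆pair {zero} p _ = zero , zero , λ { {zero} _ → inj₁ refl }
∣p∣≤2⇒⊆pair {suc n} (true ∷ p) (s≤s h) with ∣p∣≤1⇒⊆⁅⁆ p h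
... | c , p⊆c = zero , suc c , λ { Vec.here → inj₁ refl ; (Vec.there x∈p) → inj₂ (cong suc (p⊆c x∈p)) }
∣p∣≤2⇒⊆pair {suc n} (false ∷ p) h with ∣p∣≤2⇒⊆pair p h
... | a , b , p⊆ab = suc a , suc b , λ { (Vec.there x∈p) → Sum.map (cong suc) (cong suc) (p⊆ab x∈p) }

covisible-vertex⇒∣Q∣≤2 : (Q : Subset n) → CoVisibleVertex n (_∈ Q) w → ∣ Q ∣ ≤ 2
covisible-vertex⇒∣Q∣≤2 Q cv = decidable-stable (∣ Q ∣ ≤? 2) λ ∣Q∣≰2 →
  let q₁ , q₂ , q₃ , q₁∈Q , q₂∈Q , q₃∈Q , q₁<q₂ , q₂<q₃ = three-sorted Q (≰⇒> ∣Q∣≰2)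
  in  three-obstacles⇒¬covisible q₁∈Q q₂∈Q q₃∈Q q₁<q₂ q₂<q₃ cv

-- Distance on the cycle

shorterArc : ℕ → ℕ → ℕ
shorterArc n d = d ⊓ (n ∸ d)

cycleDist : (n : ℕ) → Fin n → Fin n → ℕ
cycleDist n u v = shorterArc n ∣ toℕ u - toℕ v ∣

1+m∸n≤1+[m∸n] : ∀ m n → suc m ∸ n ≤ suc (m ∸ n)
1+m∸n≤1+[m∸n] m       zero    = ≤-refl
1+m∸n≤1+[m∸n] zero    (suc n) = ≤-trans (m∸n≤m 0 n) z≤n
1+m∸n≤1+[m∸n] (suc m) (suc n) = 1+m∸n≤1+[m∸n] m n

shorterArc-lipschitz : ∀ n {d e} → d ≤ suc e → e ≤ suc d → shorterArc n d ≤ suc (shorterArc n e)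
shorterArc-lipschitz n {d} {e} d≤1+e e≤1+d =
  ⊓-mono-≤ d≤1+e (≤-trans (∸-monoʳ-≤ (suc n) e≤1+d) (1+m∸n≤1+[m∸n] n e))

shorterArc-flip : ∀ n {d} → d ≤ n → shorterArc n (n ∸ d) ≡ shorterArc n d
shorterArc-flip n {d} d≤n = trans (cong ((n ∸ d) ⊓_) (m∸[m∸n]≡n d≤n)) (⊓-comm (n ∸ d) d)

∣-∣-lipschitz : ∀ x y t → ∣ x - y ∣ ≤ 1 → ∣ x - t ∣ ≤ suc ∣ y - t ∣
∣-∣-lipschitz x y t ∣x-y∣≤1 = ≤-trans (∣-∣-triangle x y t) (+-monoˡ-≤ ∣ y - t ∣ ∣x-y∣≤1)

∣n-1+n∣≡1 : ∀ x → ∣ x - suc x ∣ ≡ 1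
∣n-1+n∣≡1 zero    = refl
∣n-1+n∣≡1 (suc x) = ∣n-1+n∣≡1 x

cycleDist-succ : (t : Fin n) → CycSucc n x y →
  cycleDist n x t ≤ suc (cycleDist n y t) × cycleDist n y t ≤ suc (cycleDist n x t)
cycleDist-succ {n = n} {x = x} {y = y} t (inj₁ 1+x≡y) =
  shorterArc-lipschitz n ∣x-t∣≤1+∣y-t∣ ∣y-t∣≤1+∣x-t∣ , shorterArc-lipschitz n ∣y-t∣≤1+∣x-t∣ ∣x-t∣≤1+∣y-t∣
  where
  ∣x-y∣≡1 : ∣ toℕ x - toℕ y ∣ ≡ 1
  ∣x-y∣≡1 = subst (λ s → ∣ toℕ x - s ∣ ≡ 1) 1+x≡y (∣n-1+n∣≡1 (toℕ x))
  ∣x-t∣≤1+∣y-t∣ : ∣ toℕ x - toℕ t ∣ ≤ suc ∣ toℕ y - toℕ t ∣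
  ∣x-t∣≤1+∣y-t∣ = ∣-∣-lipschitz (toℕ x) (toℕ y) (toℕ t) (≤-reflexive ∣x-y∣≡1)
  ∣y-t∣≤1+∣x-t∣ : ∣ toℕ y - toℕ t ∣ ≤ suc ∣ toℕ x - toℕ t ∣
  ∣y-t∣≤1+∣x-t∣ =
    ∣-∣-lipschitz (toℕ y) (toℕ x) (toℕ t) (≤-reflexive (trans (∣-∣-comm (toℕ y) (toℕ x)) ∣x-y∣≡1))
cycleDist-succ {n = n} {x = x} {y = y} t (inj₂ (1+x≡n , y≡0)) =
  subst₂ (λ dx dy → dx ≤ suc dy × dy ≤ suc dx) (sym dist-x) (sym dist-y)
    (shorterArc-lipschitz n ≤-refl t≤2+t , shorterArc-lipschitz n t≤2+t ≤-refl)
  where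
  t≤2+t : toℕ t ≤ 2 + toℕ t
  t≤2+t = m≤n+m (toℕ t) 2
  t≤x : toℕ t ≤ toℕ x
  t≤x = ≤-pred (subst (toℕ t <_) (sym 1+x≡n) (toℕ<n t))
  dist-x : cycleDist n x t ≡ shorterArc n (suc (toℕ t))
  dist-x = begin
    shorterArc n ∣ toℕ x - toℕ t ∣    ≡⟨ cong (shorterArc n) (m≤n⇒∣n-m∣≡n∸m t≤x) ⟩
    shorterArc n (toℕ x ∸ toℕ t)      ≡⟨ cong (λ m → shorterArc n (m ∸ suc (toℕ t))) 1+x≡n ⟩
    shorterArc n (n ∸ suc (toℕ t))    ≡⟨ shorterArc-flip n (toℕ<n t) ⟩
    shorterArc n (suc (toℕ t))        ∎
  dist-y : cycleDist n y t ≡ shorterArc n (toℕ t)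
  dist-y = cong (λ m → shorterArc n ∣ m - toℕ t ∣) y≡0

cycleDist-adj : (t : Fin n) → CycAdj n x y → cycleDist n x t ≤ suc (cycleDist n y t)
cycleDist-adj t (inj₁ x→y) = proj₁ (cycleDist-succ t x→y)
cycleDist-adj t (inj₂ y→x) = proj₂ (cycleDist-succ t y→x)

cycleDist≤len : (q : Walk n u v) → cycleDist n u v ≤ len q
cycleDist≤len [ u ] rewrite ∣n-n∣≡0 (toℕ u) = z≤n
cycleDist≤len {v = v} (e ∷ q) = ≤-trans (cycleDist-adj v e) (s≤s (cycleDist≤len q))

len≤cycleDist⇒shortest : (p : Walk n u v) → len p ≤ cycleDist n u v → IsShortest p
len≤cycleDist⇒shortest p p≤dist q = ≤-trans p≤dist (cycleDist≤len q)

ascending : ∀ k (u v : Fin n) → toℕ u + k ≡ toℕ v →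
  Σ (Walk n u v) λ p → len p ≡ k × All (λ x → toℕ u ≤ toℕ x × toℕ x ≤ toℕ v) (verts p)
ascending zero u v u+0≡v with toℕ-injective (trans (sym (+-identityʳ (toℕ u))) u+0≡v)
... | refl = [ u ] , refl , (≤-refl , ≤-refl) ∷ []
ascending {n} (suc k) u v u+1+k≡v =
  let p , len-p , bounds = ascending k u⁺ v u⁺+k≡v
  in  inj₁ (inj₁ (sym u⁺≡1+u)) ∷ p , cong suc len-p ,
      (≤-refl , u≤v) ∷ All.map (Product.map₁ (≤-trans u≤u⁺)) bounds
  where
  u≤v : toℕ u ≤ toℕ v
  u≤v = subst (toℕ u ≤_) u+1+k≡v (m≤m+n (toℕ u) (suc k))
  1+u<n : suc (toℕ u) < n
  1+u<n = ≤-<-trans (subst (toℕ u <_) u+1+k≡v (m<m+n (toℕ u) (s≤s z≤n))) (toℕ<n v)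
  u⁺ : Fin n
  u⁺ = fromℕ< 1+u<n
  u⁺≡1+u : toℕ u⁺ ≡ suc (toℕ u)
  u⁺≡1+u = toℕ-fromℕ< 1+u<n
  u≤u⁺ : toℕ u ≤ toℕ u⁺
  u≤u⁺ = subst (toℕ u ≤_) (sym u⁺≡1+u) (n≤1+n (toℕ u))
  u⁺+k≡v : toℕ u⁺ + k ≡ toℕ v
  u⁺+k≡v = trans (cong (_+ k) u⁺≡1+u) (trans (sym (+-suc (toℕ u) k)) u+1+k≡v)

arc-visible : ∀ k (u v : Fin n) → toℕ u + k ≡ toℕ v → k + k ≤ n →
              (∀ {x} → A x → ¬ Between u v x) → Visible n A u v
arc-visible {n = n} k u v u+k≡v 2k≤n A-outside =
  let p , len-p , bounds = ascending k u v u+k≡v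
  in  p , len≤cycleDist⇒shortest p (≤-reflexive (trans len-p (sym dist))) ,
      λ x x∈p Ax → Product.uncurry closed-interval (All.lookup bounds x∈p) (A-outside Ax)
  where
  dist : cycleDist n u v ≡ k
  dist = begin
    shorterArc n ∣ toℕ u - toℕ v ∣       ≡⟨ cong (λ m → shorterArc n ∣ toℕ u - m ∣) (sym u+k≡v) ⟩
    shorterArc n ∣ toℕ u - toℕ u + k ∣   ≡⟨ cong (shorterArc n) (∣m-m+n∣≡n (toℕ u) k) ⟩
    shorterArc n k                       ≡⟨ m≤n⇒m⊓n≡m (m+n≤o⇒m≤o∸n k 2k≤n) ⟩
    k                                    ∎

⌊n/2⌋+⌊n/2⌋≤n : ∀ d → ⌊ d /2⌋ + ⌊ d /2⌋ ≤ d
⌊n/2⌋+⌊n/2⌋≤n 0             = z≤n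
⌊n/2⌋+⌊n/2⌋≤n 1             = z≤n
⌊n/2⌋+⌊n/2⌋≤n (suc (suc d)) rewrite +-suc ⌊ d /2⌋ ⌊ d /2⌋ = s≤s (s≤s (⌊n/2⌋+⌊n/2⌋≤n d))

gap-covisible : ∀ e {a b : Fin n} → toℕ a + suc (suc e) ≡ toℕ b → ∃ (CoVisibleVertex n (Pair a b))
gap-covisible {n = n} e {a} {b} a+d≡b = c , c∉ab , λ { _ (inj₁ refl) → from-a ; _ (inj₂ refl) → from-b }
  where
  d k k′ : ℕ
  d  = suc (suc e)
  k  = ⌊ d /2⌋
  k′ = ⌈ d /2⌉
  d<n : d < n
  d<n = ≤-<-trans (subst (d ≤_) a+d≡b (m≤n+m d (toℕ a))) (toℕ<n b)
  a+k<n : toℕ a + k < n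
  a+k<n = ≤-<-trans (subst (toℕ a + k ≤_) a+d≡b (+-monoʳ-≤ (toℕ a) (⌊n/2⌋≤n d))) (toℕ<n b)
  c : Fin n
  c = fromℕ< a+k<n
  a+k≡c : toℕ a + k ≡ toℕ c
  a+k≡c = sym (toℕ-fromℕ< a+k<n)
  c+k′≡b : toℕ c + k′ ≡ toℕ b
  c+k′≡b = begin
    toℕ c + k′         ≡⟨ cong (_+ k′) a+k≡c ⟨
    toℕ a + k + k′     ≡⟨ +-assoc (toℕ a) k k′ ⟩
    toℕ a + (k + k′)   ≡⟨ cong (toℕ a +_) (⌊n/2⌋+⌈n/2⌉≡n d) ⟩
    toℕ a + d          ≡⟨ a+d≡b ⟩
    toℕ b              ∎
  a<c : toℕ a < toℕ c
  a<c = subst (toℕ a <_) a+k≡c (m<m+n (toℕ a) (s≤s z≤n))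
  c<b : toℕ c < toℕ b
  c<b = subst (toℕ c <_) c+k′≡b (m<m+n (toℕ c) (s≤s z≤n))
  c∉ab : ¬ Pair a b c
  c∉ab (inj₁ c≡a) = Finₚ.<⇒≢ a<c (sym c≡a)
  c∉ab (inj₂ c≡b) = Finₚ.<⇒≢ c<b c≡b
  from-a : Visible n (Pair a b) a c
  from-a = arc-visible k a c a+k≡c (≤-trans (⌊n/2⌋+⌊n/2⌋≤n d) (<⇒≤ d<n))
    λ { (inj₁ refl) (a<a , _) → <-irrefl refl a<a ; (inj₂ refl) (_ , b<c) → <-asym c<b b<c }
  from-b : Visible n (Pair a b) b c
  from-b = visible-sym (arc-visible k′ c b c+k′≡b (≤-trans (⌊n/2⌋+⌊n/2⌋≤n (suc d)) d<n)
    λ { (inj₁ refl) (c<a , _) → <-asym a<c c<a ; (inj₂ refl) (_ , b<b) → <-irrefl refl b<b })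

-- Rotations of the cycle

record Automorphism (n : ℕ) : Set where
  field
    to       : Fin n → Fin n
    from     : Fin n → Fin n
    to-adj   : CycAdj n x y → CycAdj n (to x) (to y)
    from-adj : CycAdj n x y → CycAdj n (from x) (from y)
    from-to  : ∀ x → from (to x) ≡ x
    to-from  : ∀ x → to (from x) ≡ x

cast-walk : u ≡ x → v ≡ y → (q : Walk n u v) → Σ (Walk n x y) λ q′ → len q′ ≡ len q
cast-walk refl refl q = q , refl

module _ (σ : Automorphism n) where
  open Automorphism σ

  visible-map : Visible n A u v → Visible n (A ∘ from) (to u) (to v)
  visible-map {A = A} {u = u} {v = v} (p , p-shortest , p-avoids) =
    map-walk to to-adj p , shortest , avoids
    where
    shortest : IsShortest (map-walk to to-adj p)
    shortest q =
      let q′ , len-q′ = cast-walk (from-to u) (from-to v) (map-walk from from-adj q)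
      in  subst₂ _≤_ (sym (len-map-walk to to-adj p)) (trans len-q′ (len-map-walk from from-adj q))
                 (p-shortest q′)
    avoids : (x : Fin n) → x ∈ₗ verts (map-walk to to-adj p) → A (from x) → Pair (to u) (to v) x
    avoids x x∈p Afx with ∈-map⁻ to (subst (x ∈ₗ_) (verts-map-walk to to-adj p) x∈p)
    ... | y , y∈p , refl = Sum.map (cong to) (cong to) (p-avoids y y∈p (subst A (from-to y) Afx))

  covisible-map : CoVisibleVertex n A w → CoVisibleVertex n (A ∘ from) (to w)
  covisible-map {A = A} {w = w} (w∉A , visible) =
    w∉A ∘ subst A (from-to w) ,
    λ u Afu → subst (λ u′ → Visible n (A ∘ from) u′ (to w)) (to-from u) (visible-map (visible (from u) Afu))

cycSucc-functional : CycSucc n x y → CycSucc n x z → y ≡ z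
cycSucc-functional (inj₁ 1+x≡y) (inj₁ 1+x≡z) = toℕ-injective (trans (sym 1+x≡y) 1+x≡z)
cycSucc-functional {y = y} (inj₁ 1+x≡y) (inj₂ (1+x≡n , _)) =
  contradiction (toℕ<n y) (<-irrefl (trans (sym 1+x≡y) 1+x≡n))
cycSucc-functional {z = z} (inj₂ (1+x≡n , _)) (inj₁ 1+x≡z) =
  contradiction (toℕ<n z) (<-irrefl (trans (sym 1+x≡z) 1+x≡n))
cycSucc-functional (inj₂ (_ , y≡0)) (inj₂ (_ , z≡0)) = toℕ-injective (trans y≡0 (sym z≡0))

cycSucc-injective : CycSucc n x z → CycSucc n y z → x ≡ y
cycSucc-injective (inj₁ 1+x≡z) (inj₁ 1+y≡z) = toℕ-injective (suc-injective (trans 1+x≡z (sym 1+y≡z)))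
cycSucc-injective (inj₁ 1+x≡z) (inj₂ (_ , z≡0)) = contradiction (trans 1+x≡z z≡0) λ ()
cycSucc-injective (inj₂ (_ , z≡0)) (inj₁ 1+y≡z) = contradiction (trans 1+y≡z z≡0) λ ()
cycSucc-injective (inj₂ (1+x≡n , _)) (inj₂ (1+y≡n , _)) =
  toℕ-injective (suc-injective (trans 1+x≡n (sym 1+y≡n)))

rotate : Fin (suc m) → Fin (suc m)
rotate {m} x with m ≟ toℕ x
... | yes _  = zero
... | no m≢x = suc (lower₁ x m≢x)

unrotate : Fin (suc m) → Fin (suc m)
unrotate zero    = fromℕ _
unrotate (suc x) = inject₁ x

cycSucc-rotate : (x : Fin (suc m)) → CycSucc (suc m) x (rotate x)
cycSucc-rotate {m} x with m ≟ toℕ x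
... | yes m≡x = inj₂ (cong suc (sym m≡x) , refl)
... | no m≢x  = inj₁ (cong suc (sym (toℕ-lower₁ x m≢x)))

cycSucc-unrotate : (x : Fin (suc m)) → CycSucc (suc m) (unrotate x) x
cycSucc-unrotate {m} zero = inj₂ (cong suc (toℕ-fromℕ m) , refl)
cycSucc-unrotate (suc x)  = inj₁ (cong suc (toℕ-inject₁ x))

rotate-cycSucc : {x y : Fin (suc m)} → CycSucc (suc m) x y → CycSucc (suc m) (rotate x) (rotate y)
rotate-cycSucc {x = x} x→y =
  subst (CycSucc _ (rotate x) ∘ rotate) (cycSucc-functional (cycSucc-rotate x) x→y)
        (cycSucc-rotate (rotate x))

unrotate-cycSucc : {x y : Fin (suc m)} → CycSucc (suc m) x y → CycSucc (suc m) (unrotate x) (unrotate y)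
unrotate-cycSucc {y = y} x→y =
  subst (λ x → CycSucc _ (unrotate x) (unrotate y)) (cycSucc-injective (cycSucc-unrotate y) x→y)
        (cycSucc-unrotate (unrotate y))

rotation : Automorphism (suc m)
rotation = record
  { to       = rotate
  ; from     = unrotate
  ; to-adj   = Sum.map rotate-cycSucc rotate-cycSucc
  ; from-adj = Sum.map unrotate-cycSucc unrotate-cycSucc
  ; from-to  = λ x → cycSucc-injective (cycSucc-unrotate (rotate x)) (cycSucc-rotate x)
  ; to-from  = λ x → cycSucc-functional (cycSucc-rotate (unrotate x)) (cycSucc-unrotate x)
  }

toℕ-unrotate : ∀ {j} {x : Fin (suc m)} → toℕ x ≡ suc j → toℕ (unrotate x) ≡ j
toℕ-unrotate {x = suc x} x≡1+j = trans (toℕ-inject₁ x) (suc-injective x≡1+j)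

-- Rotating back j times moves the adjacent pair to (n-1, 0), whose long arc 0, 1, …, n-1 does not
-- wrap around.
adjacent-covisible : ∀ j {a b : Fin (3 + m)} → toℕ b ≡ j → CycSucc _ a b → ∃ (CoVisibleVertex _ (Pair a b))
adjacent-covisible zero b≡0 (inj₁ 1+a≡b) = contradiction (trans 1+a≡b b≡0) λ ()
adjacent-covisible {m} zero b≡0 (inj₂ (1+a≡n , _)) =
  Product.map₂ (covisible-mono Sum.swap)
    (gap-covisible m (trans (cong (_+ suc (suc m)) b≡0) (sym (suc-injective 1+a≡n))))
adjacent-covisible (suc j) b≡1+j a→b =
  let c , c-covisible = adjacent-covisible j (toℕ-unrotate b≡1+j) (unrotate-cycSucc a→b)
  in  rotate c ,
      covisible-mono (Sum.map (cong unrotate) (cong unrotate)) (covisible-map rotation c-covisible)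

ordered-pair-covisible : {a b : Fin (3 + m)} → toℕ a < toℕ b → ∃ (CoVisibleVertex _ (Pair a b))
ordered-pair-covisible {a = a} {b} a<b with m≤n⇒∃[o]m+o≡n a<b
... | zero  , 1+a+0≡b   = adjacent-covisible (toℕ b) refl (inj₁ (trans (sym (+-identityʳ _)) 1+a+0≡b))
... | suc e , 1+a+1+e≡b = gap-covisible e (trans (+-suc (toℕ a) (suc e)) 1+a+1+e≡b)

singleton-covisible : (a : Fin (3 + m)) → ∃ (CoVisibleVertex _ (_≡ a))
singleton-covisible zero =
  Product.map₂ (covisible-mono inj₁) (ordered-pair-covisible {b = suc zero} (s≤s z≤n))
singleton-covisible (suc a) =
  Product.map₂ (covisible-mono inj₂) (ordered-pair-covisible {a = zero} (s≤s z≤n))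

pair-covisible : (a b : Fin (3 + m)) → ∃ (CoVisibleVertex _ (Pair a b))
pair-covisible a b with <-cmp (toℕ a) (toℕ b)
... | tri< a<b _ _ = ordered-pair-covisible a<b
... | tri> _ _ b<a = Product.map₂ (covisible-mono Sum.swap) (ordered-pair-covisible b<a)
... | tri≈ _ a≡b _ =
  Product.map₂ (covisible-mono λ { (inj₁ x≡a) → x≡a ; (inj₂ x≡b) → trans x≡b (sym (toℕ-injective a≡b)) })
    (singleton-covisible a)

∣Q∣≤2⇒covisible-vertex : (Q : Subset (3 + m)) → ∣ Q ∣ ≤ 2 → ∃ (CoVisibleVertex _ (_∈ Q))
∣Q∣≤2⇒covisible-vertex Q ∣Q∣≤2 =
  let a , b , Q⊆ab = ∣p∣≤2⇒⊆pair Q ∣Q∣≤2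
  in  Product.map₂ (covisible-mono Q⊆ab) (pair-covisible a b)

mainTheorem12 : (n : ℕ) → 3 ≤ n → (Q : Subset n) →
    (∃ λ (W : Subset n) → Nonempty W × CoVisible n Q W) ⇔ (∣ Q ∣ ≤ 2)
mainTheorem12 .(3 + m) (s≤s (s≤s (s≤s (z≤n {m})))) Q = mk⇔
  (λ (W , (w , w∈W) , W-covisible) → covisible-vertex⇒∣Q∣≤2 Q (covisible⇒covisible-vertex W-covisible w∈W))
  (λ ∣Q∣≤2 → let w , w-covisible = ∣Q∣≤2⇒covisible-vertex Q ∣Q∣≤2
             in  ⁅ w ⁆ , (w , x∈⁅x⁆ w) , covisible-vertex⇒covisible-⁅⁆ w-covisible)
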